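{- Let $M$ be a matroid, $t\in\mathbb{N}$, and $X\subseteq E(M)$. Then $M^t|S_X=(M|X)^t$ and $M^t/S_X=(M/X)^t$ (the expansions of $M|X$ and $M/X$ being formed with the same sets $S_e$).
   Context: A cyclic flat of a matroid $M$ is a flat $F$ such that $M|F$ has no coloops; $\mathcal{Z}(M)$ denotes the set of cyclic flats, and a matroid is determined by its cyclic flats and their ranks. The $t$-expansion: for each $e\in E(M)$ let $S_e$ be a $t$-element set with $e\in S_e$, the sets $S_e$ pairwise disjoint; for $X\subseteq E(M)$ let $S_X=\bigcup_{e\in X}S_e$. The $t$-expansion $M^t$ is the matroid on $S_{E(M)}$ whose cyclic flats are exactly the sets $S_A$ with $A\in\mathcal{Z}(M)$, with $r_{M^t}(S_A)=t\cdot r_M(A)$. -}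

module Defs where

open import Data.Nat using (ℕ; zero; suc; _+_; _*_; _∸_; _≤_; _<_)
open import Data.Nat.Properties using (≤-antisym; +-cancelʳ-≤; +-assoc; +-comm; m∸n+n≡m; m≤n+o⇒m∸n≤o; m≤m+n; +-monoˡ-≤; ∸-monoˡ-≤; module ≤-Reasoning)
open import Data.Bool using (Bool; true; false; _∧_; _∨_; not; T)
open import Data.Bool.Properties using (T-∧; T-∨)
open import Data.Fin using (Fin)
open import Data.Fin.Properties using () renaming (_≟_ to _≟F_)
open import Data.List using (List; []; _∷_; allFin; cartesianProduct)
open import Data.Product using (Σ; ∃; _×_; _,_; proj₁; proj₂)
open import Data.Product.Properties using (≡-dec)
open import Data.Sum using (_⊎_; inj₁; inj₂)
open import Function.Bundles using (_⇔_)
open import Relation.Binary.Definitions using (DecidableEquality)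
open import Relation.Binary.PropositionalEquality
open import Relation.Nullary using (¬_; does)

-- Carrier with decidable equality and an enumeration (without
-- repetitions) of all its elements; only the two concrete instances
-- FinU and ProdU below are used in the statement.

record Univ : Set₁ where
  field
    Carrier : Set
    _≟_     : DecidableEquality Carrier
    elems   : List Carrier
open Univ public using (Carrier)

FinU : ℕ → Univ
FinU n = record { Carrier = Fin n ; _≟_ = _≟F_ ; elems = allFin n }

-- universe for the t-expansion: element e of Fin n gives
-- S_e = { (e , i) ∣ i : Fin t }
ProdU : ℕ → ℕ → Univ
ProdU n t = record
  { Carrier = Fin n × Fin t
  ; _≟_     = ≡-dec _≟F_ _≟F_
  ; elems   = cartesianProduct (allFin n) (allFin t) }

record Subset (U : Univ) : Set where
  constructor mkSubset
  field at : Carrier U → Bool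
open Subset public

module _ {U : Univ} where
  open Univ U using (_≟_; elems)
  private C = Univ.Carrier U

  infixr 6 _∪_ _∩_ _∖_
  infix 4 _∈ₛ_ _⊆_ _≐_

  _∈ₛ_ : C → Subset U → Set
  x ∈ₛ X = T (at X x)

  _⊆_ : Subset U → Subset U → Set
  X ⊆ Y = ∀ x → x ∈ₛ X → x ∈ₛ Y

  _≐_ : Subset U → Subset U → Set
  X ≐ Y = ∀ x → at X x ≡ at Y x

  _∪_ _∩_ _∖_ : Subset U → Subset U → Subset U
  X ∪ Y = mkSubset λ x → at X x ∨ at Y x
  X ∩ Y = mkSubset λ x → at X x ∧ at Y x
  X ∖ Y = mkSubset λ x → at X x ∧ not (at Y x)

  ⁅_⁆ : C → Subset U
  ⁅ e ⁆ = mkSubset λ x → does (x ≟ e)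

  card : Subset U → ℕ
  card X = go elems
    where
    go : List C → ℕ
    go []       = 0
    go (x ∷ xs) with at X x
    ... | true  = suc (go xs)
    ... | false = go xs

-- Matroids, via the rank axioms.  The ground set is E ⊆ universe;
-- r is only meaningful on subsets of E.

record Matroid (U : Univ) : Set where
  field
    E      : Subset U
    r      : Subset U → ℕ
    r-card : ∀ X → X ⊆ E → r X ≤ card X
    r-mono : ∀ X Y → X ⊆ Y → Y ⊆ E → r X ≤ r Y
    r-sub  : ∀ X Y → X ⊆ E → Y ⊆ E → r (X ∪ Y) + r (X ∩ Y) ≤ r X + r Y
open Matroid public

private
  ∧-l : ∀ {a b} → T (a ∧ b) → T a
  ∧-l p = proj₁ (Equivalence.to T-∧ p) where open import Function.Bundles using (Equivalence)
  ∧-r : ∀ {a b} → T (a ∧ b) → T b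
  ∧-r p = proj₂ (Equivalence.to T-∧ p) where open import Function.Bundles using (Equivalence)
  ∧-i : ∀ {a b} → T a → T b → T (a ∧ b)
  ∧-i p q = Equivalence.from T-∧ (p , q) where open import Function.Bundles using (Equivalence)
  ∨-e : ∀ {a b} → T (a ∨ b) → T a ⊎ T b
  ∨-e p = Equivalence.to T-∨ p where open import Function.Bundles using (Equivalence)
  ∨-l : ∀ {a b} → T a → T (a ∨ b)
  ∨-l p = Equivalence.from T-∨ (inj₁ p) where open import Function.Bundles using (Equivalence)
  ∨-r : ∀ {a b} → T b → T (a ∨ b)
  ∨-r p = Equivalence.from T-∨ (inj₂ p) where open import Function.Bundles using (Equivalence)

  dist : ∀ a b c → (a ∨ c) ∧ (b ∨ c) ≡ (a ∧ b) ∨ c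
  dist false b false = refl
  dist false false true = refl
  dist false true true = refl
  dist true  false false = refl
  dist true  true false = refl
  dist true  false true = refl
  dist true  true  true = refl

  or3 : ∀ a b c → (a ∨ c) ∨ (b ∨ c) ≡ (a ∨ b) ∨ c
  or3 true  b c = refl
  or3 false true  false = refl
  or3 false true  true  = refl
  or3 false false false = refl
  or3 false false true  = refl

  rank-≐ : ∀ {U} (M : Matroid U) X Y → X ≐ Y → Y ⊆ E M → r M X ≡ r M Y
  rank-≐ M X Y eq Y⊆E = ≤-antisym
    (r-mono M X Y (λ x p → subst T (eq x) p) Y⊆E)
    (r-mono M Y X (λ x p → subst T (sym (eq x)) p) (λ x p → Y⊆E x (subst T (eq x) p)))

  arith : ∀ a b c d k → k ≤ a → k ≤ b → k ≤ c → k ≤ d → a + b ≤ c + d →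
          (a ∸ k) + (b ∸ k) ≤ (c ∸ k) + (d ∸ k)
  arith a b c d k ka kb kc kd le =
    +-cancelʳ-≤ (k + k) _ _ (subst₂ _≤_ (sym (eq a b ka kb)) (sym (eq c d kc kd)) le)
    where
    eq : ∀ x y → k ≤ x → k ≤ y → (x ∸ k) + (y ∸ k) + (k + k) ≡ x + y
    eq x y kx ky = begin
      (x ∸ k) + (y ∸ k) + (k + k)  ≡⟨ +-assoc (x ∸ k) (y ∸ k) (k + k) ⟩
      (x ∸ k) + ((y ∸ k) + (k + k)) ≡⟨ cong ((x ∸ k) +_) (sym (+-assoc (y ∸ k) k k)) ⟩
      (x ∸ k) + ((y ∸ k) + k + k)   ≡⟨ cong (λ z → (x ∸ k) + (z + k)) (m∸n+n≡m ky) ⟩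
      (x ∸ k) + (y + k)             ≡⟨ cong ((x ∸ k) +_) (+-comm y k) ⟩
      (x ∸ k) + (k + y)             ≡⟨ sym (+-assoc (x ∸ k) k y) ⟩
      (x ∸ k) + k + y               ≡⟨ cong (_+ y) (m∸n+n≡m kx) ⟩
      x + y ∎
      where open ≡-Reasoning

infixl 8 _∣_ _/_

_∣_ : ∀ {U} → Matroid U → Subset U → Matroid U
M ∣ X = record
  { E      = X ∩ E M
  ; r      = r M
  ; r-card = λ Y p → r-card M Y (λ x q → ∧-r (p x q))
  ; r-mono = λ Y Z p q → r-mono M Y Z p (λ x s → ∧-r (q x s))
  ; r-sub  = λ Y Z p q → r-sub M Y Z (λ x s → ∧-r (p x s)) (λ x s → ∧-r (q x s))
  }

_/_ : ∀ {U} → Matroid U → Subset U → Matroid U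
_/_ {U} M X = record
  { E      = E M ∖ X
  ; r      = λ Y → r M (Y ∪ X') ∸ r M X'
  ; r-card = rc
  ; r-mono = rm
  ; r-sub  = rs
  }
  where
  X' : Subset U
  X' = X ∩ E M
  X'⊆E : X' ⊆ E M
  X'⊆E x p = ∧-r p
  ∪X'⊆E : ∀ Y → Y ⊆ (E M ∖ X) → (Y ∪ X') ⊆ E M
  ∪X'⊆E Y p x q with ∨-e q
  ... | inj₁ a = ∧-l (p x a)
  ... | inj₂ b = ∧-r b
  ⊆E : ∀ Y → Y ⊆ (E M ∖ X) → Y ⊆ E M
  ⊆E Y p x q = ∧-l (p x q)
  k≤ : ∀ Y → Y ⊆ (E M ∖ X) → r M X' ≤ r M (Y ∪ X')
  k≤ Y p = r-mono M X' (Y ∪ X') (λ x q → ∨-r q) (∪X'⊆E Y p)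

  rc : ∀ Y → Y ⊆ (E M ∖ X) → r M (Y ∪ X') ∸ r M X' ≤ card Y
  rc Y p = m≤n+o⇒m∸n≤o (r M (Y ∪ X')) (r M X') (begin
    r M (Y ∪ X')                    ≤⟨ m≤m+n _ _ ⟩
    r M (Y ∪ X') + r M (Y ∩ X')     ≤⟨ r-sub M Y X' (⊆E Y p) X'⊆E ⟩
    r M Y + r M X'                  ≤⟨ +-monoˡ-≤ (r M X') (r-card M Y (⊆E Y p)) ⟩
    card Y + r M X'                 ≡⟨ +-comm (card Y) _ ⟩
    r M X' + card Y ∎)
    where open ≤-Reasoning

  rm : ∀ Y Z → Y ⊆ Z → Z ⊆ (E M ∖ X) →
       r M (Y ∪ X') ∸ r M X' ≤ r M (Z ∪ X') ∸ r M X'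
  rm Y Z p q = ∸-monoˡ-≤ (r M X') (r-mono M (Y ∪ X') (Z ∪ X') s (∪X'⊆E Z q))
    where
    s : (Y ∪ X') ⊆ (Z ∪ X')
    s x a with ∨-e a
    ... | inj₁ y = ∨-l (p x y)
    ... | inj₂ b = ∨-r b

  rs : ∀ Y Z → Y ⊆ (E M ∖ X) → Z ⊆ (E M ∖ X) →
       (r M ((Y ∪ Z) ∪ X') ∸ r M X') + (r M ((Y ∩ Z) ∪ X') ∸ r M X')
         ≤ (r M (Y ∪ X') ∸ r M X') + (r M (Z ∪ X') ∸ r M X')
  rs Y Z p q = arith _ _ _ _ _ (k≤ (Y ∪ Z) pq) (k≤ (Y ∩ Z) pr) (k≤ Y p) (k≤ Z q)
    (subst₂ (λ a b → a + b ≤ r M (Y ∪ X') + r M (Z ∪ X'))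
      (rank-≐ M _ _ e1 (∪X'⊆E (Y ∪ Z) pq))
      (rank-≐ M _ _ e2 (∪X'⊆E (Y ∩ Z) pr))
      (r-sub M (Y ∪ X') (Z ∪ X') (∪X'⊆E Y p) (∪X'⊆E Z q)))
    where
    pq : (Y ∪ Z) ⊆ (E M ∖ X)
    pq x a with ∨-e a
    ... | inj₁ y = p x y
    ... | inj₂ z = q x z
    pr : (Y ∩ Z) ⊆ (E M ∖ X)
    pr x a = p x (∧-l a)
    e1 : ((Y ∪ X') ∪ (Z ∪ X')) ≐ ((Y ∪ Z) ∪ X')
    e1 x = or3 (at Y x) (at Z x) (at X' x)
    e2 : ((Y ∪ X') ∩ (Z ∪ X')) ≐ ((Y ∩ Z) ∪ X')
    e2 x = dist (at Y x) (at Z x) (at X' x)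

IsColoop : ∀ {U} → Matroid U → Carrier U → Set
IsColoop M e = e ∈ₛ E M × r M (E M ∖ ⁅ e ⁆) < r M (E M)

HasNoColoops : ∀ {U} → Matroid U → Set
HasNoColoops M = ∀ e → ¬ IsColoop M e

IsFlat : ∀ {U} → Matroid U → Subset U → Set
IsFlat M F = F ⊆ E M × (∀ e → e ∈ₛ E M → ¬ (e ∈ₛ F) → r M F < r M (F ∪ ⁅ e ⁆))

IsCyclicFlat : ∀ {U} → Matroid U → Subset U → Set
IsCyclicFlat M F = IsFlat M F × HasNoColoops (M ∣ F)

S : ∀ {n} (t : ℕ) → Subset (FinU n) → Subset (ProdU n t)
S t X = mkSubset λ { (e , i) → at X e }

-- N is the t-expansion M^t of M: N is a matroid on S_{E(M)} whose
-- cyclic flats are exactly the sets S_A, A ∈ Z(M), with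
-- r_N(S_A) = t · r_M(A).  (A matroid is determined by its cyclic flats
-- and their ranks, so this characterises M^t uniquely.)
IsExpansion : ∀ {n} (t : ℕ) → Matroid (FinU n) → Matroid (ProdU n t) → Set
IsExpansion t M N =
    (E N ≐ S t (E M))
  × (∀ F → IsCyclicFlat N F ⇔ (∃ λ A → IsCyclicFlat M A × F ≐ S t A))
  × (∀ A → IsCyclicFlat M A → r N (S t A) ≡ t * r M A)

-- The expansion N = M^t is characterised by its rank function
--   r_N(Y) = min { t·r_M(B) + |Y − S_B| : B ⊆ E(M) }.
-- Every set Y is dominated by a cyclic flat Z (r(Z) + |Y − Z| ≤ r(Y)), so the
-- minimum may be taken over cyclic flats, where r_N(S_A) = t·r_M(A) is known;
-- conversely, in a matroid with this rank function the cyclic flats are exactly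
-- the S_A with A ∈ Z(M).  The formula passes to restrictions (replace B by B ∩ X)
-- and to contractions (evaluate at Y ∪ S_X and subtract r_N(S_X) = t·r_M(X)).

module Submission where

open import Defs
open import Data.Bool using (Bool; true; false; _∧_; _∨_; not; T; if_then_else_)
open import Data.Bool.Properties using (T-∧; T-∨)
open import Data.Empty using (⊥-elim)
open import Data.Fin using (Fin)
import Data.Fin
open import Data.List using (List; []; _∷_; _++_; map; length; allFin; cartesianProduct)
open import Data.List.Properties using (length-tabulate)
open import Data.List.Membership.Propositional using (_∈_)
open import Data.List.Membership.Propositional.Properties using (∈-allFin; ∈-cartesianProduct⁺)
open import Data.List.Relation.Unary.All as All using (All; []; _∷_)
open import Data.List.Relation.Unary.AllPairs using (_∷_)
open import Data.List.Relation.Unary.Any as Any using (here; there; any?)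
open import Data.List.Relation.Unary.Unique.Propositional using (Unique)
open import Data.List.Relation.Unary.Unique.Propositional.Properties using (allFin⁺; cartesianProduct⁺)
open import Data.Nat using (ℕ; zero; suc; _+_; _*_; _∸_; _≤_; _<_; z≤n; s≤s)
open import Data.Nat.Induction using (<-wellFounded)
open import Data.Nat.Properties
open import Data.Product using (∃; _×_; _,_; proj₁; proj₂)
open import Data.Sum using (_⊎_; inj₁; inj₂)
open import Data.Unit using (tt)
open import Function using (_∘_; id)
open import Function.Bundles using (Equivalence; _⇔_; mk⇔)
open import Induction.WellFounded using (Acc; acc)
open import Relation.Binary.Definitions using (DecidableEquality)
open import Relation.Binary.PropositionalEquality
open import Relation.Nullary using (¬_; Dec; yes; no; does)
open import Relation.Nullary.Decidable using (T?; _×-dec_)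

T-does : {P : Set} (d : Dec P) → T (does d) → P
T-does (yes p) _ = p

does-T : {P : Set} (d : Dec P) → P → T (does d)
does-T (yes _)  _ = tt
does-T (no ¬p) p = ¬p p

¬T⇒T-not : ∀ {b} → ¬ T b → T (not b)
¬T⇒T-not {true}  ¬t = ¬t tt
¬T⇒T-not {false} _  = tt

T-not⇒¬T : ∀ {b} → T (not b) → ¬ T b
T-not⇒¬T {true}  () _
T-not⇒¬T {false} _  ()

count : {A : Set} → (A → Bool) → List A → ℕ
count p []       = 0
count p (x ∷ xs) = if p x then suc (count p xs) else count p xs

module _ {A : Set} where

  count-cong : ∀ {p q : A → Bool} xs → (∀ x → p x ≡ q x) → count p xs ≡ count q xs
  count-cong []       p≗q = refl
  count-cong {q = q} (x ∷ xs) p≗q rewrite p≗q x with q x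
  ... | true  = cong suc (count-cong xs p≗q)
  ... | false = count-cong xs p≗q

  count-mono : ∀ {p q : A → Bool} xs → (∀ x → T (p x) → T (q x)) → count p xs ≤ count q xs
  count-mono []                   p⇒q = z≤n
  count-mono {p} {q} (x ∷ xs) p⇒q with p x | q x | p⇒q x
  ... | true  | true  | _   = s≤s (count-mono xs p⇒q)
  ... | true  | false | p⇒f = ⊥-elim (p⇒f tt)
  ... | false | true  | _   = m≤n⇒m≤1+n (count-mono xs p⇒q)
  ... | false | false | _   = count-mono xs p⇒q

  count-split : ∀ (p q : A → Bool) xs →
                count p xs ≡ count (λ x → p x ∧ q x) xs + count (λ x → p x ∧ not (q x)) xs
  count-split p q []       = refl
  count-split p q (x ∷ xs) with p x | q x
  ... | true  | true  = cong suc (count-split p q xs)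
  ... | true  | false = trans (cong suc (count-split p q xs)) (sym (+-suc _ _))
  ... | false | _     = count-split p q xs

  count-none : ∀ {p : A → Bool} xs → All (λ x → ¬ T (p x)) xs → count p xs ≡ 0
  count-none      []       []             = refl
  count-none {p} (x ∷ xs) (¬px ∷ none) with p x
  ... | true  = ⊥-elim (¬px tt)
  ... | false = count-none xs none

  count-≟ : ∀ (_≟_ : DecidableEquality A) {x} xs → Unique xs → x ∈ xs →
            count (λ y → does (y ≟ x)) xs ≡ 1
  count-≟ _≟_ {x} (_ ∷ xs) (x∉xs ∷ _) (here refl) with x ≟ x
  ... | yes _  = cong suc (count-none xs (All.map (λ {z} x≢z z≡x → x≢z (sym (T-does (z ≟ x) z≡x))) x∉xs))
  ... | no x≢x = ⊥-elim (x≢x refl)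
  count-≟ _≟_ {x} (y ∷ xs) (y∉xs ∷ u) (there x∈xs) with y ≟ x
  ... | yes refl = ⊥-elim (All.lookup y∉xs x∈xs refl)
  ... | no _     = count-≟ _≟_ xs u x∈xs

  count-++ : ∀ (p : A → Bool) xs ys → count p (xs ++ ys) ≡ count p xs + count p ys
  count-++ p []       ys = refl
  count-++ p (x ∷ xs) ys with p x
  ... | true  = cong suc (count-++ p xs ys)
  ... | false = count-++ p xs ys

count-cartesianProduct : ∀ {A B : Set} (p : A → Bool) xs (ys : List B) →
  count (λ xy → p (proj₁ xy)) (cartesianProduct xs ys) ≡ length ys * count p xs
count-cartesianProduct p []       ys = sym (*-zeroʳ (length ys))
count-cartesianProduct p (x ∷ xs) ys = begin
  count p₁ (map (x ,_) ys ++ cartesianProduct xs ys)          ≡⟨ count-++ p₁ (map (x ,_) ys) _ ⟩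
  count p₁ (map (x ,_) ys) + count p₁ (cartesianProduct xs ys) ≡⟨ cong₂ _+_ (row ys) (count-cartesianProduct p xs ys) ⟩
  (if p x then length ys else 0) + length ys * count p xs     ≡⟨ distribute (p x) ⟩
  length ys * count p (x ∷ xs)                                ∎
  where
  open ≡-Reasoning
  p₁ = λ xy → p (proj₁ xy)
  row : ∀ zs → count p₁ (map (x ,_) zs) ≡ (if p x then length zs else 0)
  row []       with p x
  ... | true  = refl
  ... | false = refl
  row (z ∷ zs) with p x | row zs
  ... | true  | eq = cong suc eq
  ... | false | eq = eq
  distribute : ∀ b → (if b then length ys else 0) + length ys * count p xs
                     ≡ length ys * (if b then suc (count p xs) else count p xs)
  distribute true  = sym (*-suc (length ys) _)
  distribute false = refl

-- `card` is defined through a helper local to Defs.  Abstracting the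
-- enumeration to a variable lets unification solve the function index of
-- CountedBy with that helper, which is then compared with `count` by
-- induction on the list.
private
  record CountedBy {A : Set} (n : ℕ) (f : List A → ℕ) (xs : List A) : Set where
    constructor countedBy
    field n≡f-xs : n ≡ f xs

  cardCountedBy : {U : Univ} (X : Subset U) → CountedBy (card X) _ (Univ.elems U)
  cardCountedBy {U} X with Univ.elems U
  ... | _ = countedBy refl

  counter : ∀ {A n f xs} → CountedBy {A} n f xs → List A → ℕ
  counter {f = f} _ = f

  counter≡count : {U : Univ} (X : Subset U) (xs : List (Carrier U)) →
                  counter (cardCountedBy X) xs ≡ count (at X) xs
  counter≡count X []       = refl
  counter≡count X (x ∷ xs) with at X x
  ... | true  = cong suc (counter≡count X xs)
  ... | false = counter≡count X xs

card≡count : {U : Univ} (X : Subset U) → card X ≡ count (at X) (Univ.elems U)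
card≡count {U} X = counter≡count X (Univ.elems U)

module _ {U : Univ} where

  infix 4 _∉ₛ_ _∈?ₛ_
  _∉ₛ_ : Carrier U → Subset U → Set
  x ∉ₛ X = ¬ x ∈ₛ X

  module _ (X Y : Subset U) {x : Carrier U} where

    ∩⁺ : x ∈ₛ X → x ∈ₛ Y → x ∈ₛ X ∩ Y
    ∩⁺ x∈X x∈Y = Equivalence.from T-∧ (x∈X , x∈Y)

    ∩⁻ : x ∈ₛ X ∩ Y → x ∈ₛ X × x ∈ₛ Y
    ∩⁻ = Equivalence.to T-∧

    ∪⁺ˡ : x ∈ₛ X → x ∈ₛ X ∪ Y
    ∪⁺ˡ x∈X = Equivalence.from T-∨ (inj₁ x∈X)

    ∪⁺ʳ : x ∈ₛ Y → x ∈ₛ X ∪ Y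
    ∪⁺ʳ x∈Y = Equivalence.from T-∨ (inj₂ x∈Y)

    ∪⁻ : x ∈ₛ X ∪ Y → x ∈ₛ X ⊎ x ∈ₛ Y
    ∪⁻ = Equivalence.to T-∨

    ∖⁺ : x ∈ₛ X → x ∉ₛ Y → x ∈ₛ X ∖ Y
    ∖⁺ x∈X x∉Y = Equivalence.from T-∧ (x∈X , ¬T⇒T-not x∉Y)

    ∖⁻ : x ∈ₛ X ∖ Y → x ∈ₛ X × x ∉ₛ Y
    ∖⁻ p = let x∈X , x∉Y = Equivalence.to (T-∧ {at X x}) p in x∈X , T-not⇒¬T x∉Y

  _∈?ₛ_ : (x : Carrier U) (X : Subset U) → Dec (x ∈ₛ X)
  x ∈?ₛ X = T? (at X x)

  ∪-⊆ : (X Y : Subset U) {Z : Subset U} → X ⊆ Z → Y ⊆ Z → X ∪ Y ⊆ Z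
  ∪-⊆ X Y X⊆Z Y⊆Z x x∈X∪Y with ∪⁻ X Y x∈X∪Y
  ... | inj₁ x∈X = X⊆Z x x∈X
  ... | inj₂ x∈Y = Y⊆Z x x∈Y

  ∖-⊆ : (X Y : Subset U) → X ∖ Y ⊆ X
  ∖-⊆ X Y x x∈X∖Y = proj₁ (∖⁻ X Y x∈X∖Y)

  ∩-⊆ˡ : (X Y : Subset U) → X ∩ Y ⊆ X
  ∩-⊆ˡ X Y x x∈X∩Y = proj₁ (∩⁻ X Y x∈X∩Y)

  ∩-⊆ʳ : (X Y : Subset U) → X ∩ Y ⊆ Y
  ∩-⊆ʳ X Y x x∈X∩Y = proj₂ (∩⁻ X Y x∈X∩Y)

  module _ (X : Subset U) {x : Carrier U} where

    ∪⁅⁆⁺ : x ∈ₛ X ∪ ⁅ x ⁆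
    ∪⁅⁆⁺ = ∪⁺ʳ X ⁅ x ⁆ (does-T (Univ._≟_ U x x) refl)

    ∖⁅⁆⁺ : ∀ {y} → y ∈ₛ X → y ≢ x → y ∈ₛ X ∖ ⁅ x ⁆
    ∖⁅⁆⁺ {y} y∈X y≢x = ∖⁺ X ⁅ x ⁆ y∈X (y≢x ∘ T-does (Univ._≟_ U y x))

    ∖⁅⁆⁻ : ∀ {y} → y ∈ₛ X ∖ ⁅ x ⁆ → y ∈ₛ X × y ≢ x
    ∖⁅⁆⁻ {y} p = let y∈X , y∉x = ∖⁻ X ⁅ x ⁆ p in y∈X , y∉x ∘ does-T (Univ._≟_ U y x)

    ∉∖⁅⁆ : x ∉ₛ X ∖ ⁅ x ⁆
    ∉∖⁅⁆ p = proj₂ (∖⁅⁆⁻ p) refl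

module Subsets (U : Univ) where

  ⊆-refl : {X : Subset U} → X ⊆ X
  ⊆-refl _ x∈X = x∈X

  ⊆-trans : {X Y Z : Subset U} → X ⊆ Y → Y ⊆ Z → X ⊆ Z
  ⊆-trans X⊆Y Y⊆Z x x∈X = Y⊆Z x (X⊆Y x x∈X)

  ≐⇒⊆ : {X Y : Subset U} → X ≐ Y → X ⊆ Y
  ≐⇒⊆ X≐Y x = subst T (X≐Y x)

  ≐⇒⊇ : {X Y : Subset U} → X ≐ Y → Y ⊆ X
  ≐⇒⊇ X≐Y x = subst T (sym (X≐Y x))

  ≐-sym : {X Y : Subset U} → X ≐ Y → Y ≐ X
  ≐-sym X≐Y x = sym (X≐Y x)

  ⊆-antisym : {X Y : Subset U} → X ⊆ Y → Y ⊆ X → X ≐ Y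
  ⊆-antisym {X} {Y} X⊆Y Y⊆X x with at X x in eqX | at Y x in eqY
  ... | true  | true  = refl
  ... | false | false = refl
  ... | true  | false = ⊥-elim (subst T eqY (X⊆Y x (subst T (sym eqX) tt)))
  ... | false | true  = ⊥-elim (subst T eqX (Y⊆X x (subst T (sym eqY) tt)))

  ⊆⇒∩≐ : {X Y : Subset U} → X ⊆ Y → X ∩ Y ≐ X
  ⊆⇒∩≐ {X} {Y} X⊆Y = ⊆-antisym (∩-⊆ˡ X Y) λ x x∈X → ∩⁺ X Y x∈X (X⊆Y x x∈X)

  ∖-monoˡ : {X Y Z : Subset U} → X ⊆ Y → X ∖ Z ⊆ Y ∖ Z
  ∖-monoˡ {X} {Y} {Z} X⊆Y x p = let x∈X , x∉Z = ∖⁻ X Z p in ∖⁺ Y Z (X⊆Y x x∈X) x∉Z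

  ∪-monoˡ : {X Y Z : Subset U} → X ⊆ Y → X ∪ Z ⊆ Y ∪ Z
  ∪-monoˡ {X} {Y} {Z} X⊆Y = ∪-⊆ X Z (λ x x∈X → ∪⁺ˡ Y Z (X⊆Y x x∈X)) (λ _ → ∪⁺ʳ Y Z)

  ∖-monoʳ : {X Y Z : Subset U} → Y ⊆ Z → X ∖ Z ⊆ X ∖ Y
  ∖-monoʳ {X} {Y} {Z} Y⊆Z x p = let x∈X , x∉Z = ∖⁻ X Z p in ∖⁺ X Y x∈X (x∉Z ∘ Y⊆Z x)

  ∖-congʳ : {X Y Z : Subset U} → Y ≐ Z → X ∖ Y ≐ X ∖ Z
  ∖-congʳ {X} Y≐Z x = cong (λ b → at X x ∧ not b) (Y≐Z x)

  ∪-congˡ : {X Y Z : Subset U} → X ≐ Y → X ∪ Z ≐ Y ∪ Z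
  ∪-congˡ {Z = Z} X≐Y x = cong (_∨ at Z x) (X≐Y x)

  ∖-congˡ : {X Y Z : Subset U} → X ≐ Y → X ∖ Z ≐ Y ∖ Z
  ∖-congˡ {Z = Z} X≐Y x = cong (_∧ not (at Z x)) (X≐Y x)

  ⊆-∖⁅⁆ : {X Y : Subset U} {x : Carrier U} → X ⊆ Y → x ∉ₛ X → X ⊆ Y ∖ ⁅ x ⁆
  ⊆-∖⁅⁆ {Y = Y} X⊆Y x∉X y y∈X = ∖⁅⁆⁺ Y (X⊆Y y y∈X) λ { refl → x∉X y∈X }

  ⁅⁆-⊆ : {X : Subset U} {x : Carrier U} → x ∈ₛ X → ⁅ x ⁆ ⊆ X
  ⁅⁆-⊆ {X} {x} x∈X y y∈x = subst (_∈ₛ X) (sym (T-does (Univ._≟_ U y x) y∈x)) x∈X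

  card-cong : {X Y : Subset U} → X ≐ Y → card X ≡ card Y
  card-cong {X} {Y} X≐Y = begin
    card X                           ≡⟨ card≡count X ⟩
    count (at X) (Univ.elems U)      ≡⟨ count-cong (Univ.elems U) X≐Y ⟩
    count (at Y) (Univ.elems U)      ≡⟨ card≡count Y ⟨
    card Y                           ∎
    where open ≡-Reasoning

  card-mono : {X Y : Subset U} → X ⊆ Y → card X ≤ card Y
  card-mono {X} {Y} X⊆Y = subst₂ _≤_ (sym (card≡count X)) (sym (card≡count Y))
                                     (count-mono (Univ.elems U) X⊆Y)

  card-split : (X Y : Subset U) → card X ≡ card (X ∩ Y) + card (X ∖ Y)
  card-split X Y = begin
    card X                                                   ≡⟨ card≡count X ⟩
    count (at X) (Univ.elems U)                              ≡⟨ count-split (at X) (at Y) (Univ.elems U) ⟩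
    count (at (X ∩ Y)) (Univ.elems U) + count (at (X ∖ Y)) (Univ.elems U)
                                                             ≡⟨ cong₂ _+_ (card≡count (X ∩ Y)) (card≡count (X ∖ Y)) ⟨
    card (X ∩ Y) + card (X ∖ Y)                              ∎
    where open ≡-Reasoning

  card-∖-⊆ : {X Y : Subset U} → X ⊆ Y → card (X ∖ Y) ≡ 0
  card-∖-⊆ {X} {Y} X⊆Y = trans (card≡count (X ∖ Y)) (count-none (Univ.elems U) (All.universal empty _))
    where
    empty : ∀ x → x ∉ₛ X ∖ Y
    empty x x∈X∖Y = let x∈X , x∉Y = ∖⁻ X Y x∈X∖Y in x∉Y (X⊆Y x x∈X)

  card-∪ : (X Y : Subset U) → card (X ∪ Y) ≤ card X + card Y
  card-∪ X Y = subst (_≤ card X + card Y) (sym (card-split (X ∪ Y) X))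
    (+-mono-≤ (card-mono (∩-⊆ʳ (X ∪ Y) X)) (card-mono (λ x p → new x (∖⁻ (X ∪ Y) X p))))
    where
    new : ∀ x → x ∈ₛ X ∪ Y × x ∉ₛ X → x ∈ₛ Y
    new x (x∈X∪Y , x∉X) with ∪⁻ X Y x∈X∪Y
    ... | inj₁ x∈X = ⊥-elim (x∉X x∈X)
    ... | inj₂ x∈Y = x∈Y

  card-∖-triangle : (X Y Z : Subset U) → card (X ∖ Z) ≤ card (X ∖ Y) + card (Y ∖ Z)
  card-∖-triangle X Y Z = ≤-trans (card-mono split) (card-∪ (X ∖ Y) (Y ∖ Z))
    where
    split : X ∖ Z ⊆ (X ∖ Y) ∪ (Y ∖ Z)
    split x x∈X∖Z with ∖⁻ X Z x∈X∖Z | x ∈?ₛ Y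
    ... | x∈X , x∉Z | yes x∈Y = ∪⁺ʳ (X ∖ Y) (Y ∖ Z) (∖⁺ Y Z x∈Y x∉Z)
    ... | x∈X , x∉Z | no x∉Y  = ∪⁺ˡ (X ∖ Y) (Y ∖ Z) (∖⁺ X Y x∈X x∉Y)

  card-disjoint-≤ : {X Y Z : Subset U} → X ⊆ Z → Y ⊆ Z → (∀ x → x ∈ₛ Y → x ∉ₛ X) →
                    card X + card Y ≤ card Z
  card-disjoint-≤ {X} {Y} {Z} X⊆Z Y⊆Z disjoint = subst (card X + card Y ≤_) (sym (card-split Z X))
    (+-mono-≤ (card-mono λ x x∈X → ∩⁺ Z X (X⊆Z x x∈X) x∈X)
              (card-mono λ y y∈Y → ∖⁺ Z X (Y⊆Z y y∈Y) (disjoint y y∈Y)))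

record IsEnumerated (U : Univ) : Set where
  field
    complete : ∀ x → x ∈ Univ.elems U
    unique   : Unique (Univ.elems U)

module Finite {U : Univ} (enum : IsEnumerated U) where
  open IsEnumerated enum
  open Subsets U public

  ∃? : {P : Carrier U → Set} → (∀ x → Dec (P x)) → Dec (∃ P)
  ∃? P? with any? P? (Univ.elems U)
  ... | yes some = yes (Any.satisfied some)
  ... | no  none = no λ (x , px) → none (Any.map (λ { refl → px }) (complete x))

  card-⁅⁆ : (x : Carrier U) → card (⁅_⁆ {U} x) ≡ 1
  card-⁅⁆ x = trans (card≡count (⁅_⁆ {U} x)) (count-≟ (Univ._≟_ U) (Univ.elems U) unique (complete x))

  card-∖⁅⁆ : {X : Subset U} {x : Carrier U} → x ∈ₛ X → card X ≡ suc (card (X ∖ ⁅ x ⁆))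
  card-∖⁅⁆ {X} {x} x∈X = begin
    card X                                   ≡⟨ card-split X ⁅ x ⁆ ⟩
    card (X ∩ ⁅ x ⁆) + card (X ∖ ⁅ x ⁆)      ≡⟨ cong (_+ card (X ∖ ⁅ x ⁆)) X∩x≡1 ⟩
    suc (card (X ∖ ⁅ x ⁆))                   ∎
    where
    open ≡-Reasoning
    X∩x≐x : X ∩ ⁅ x ⁆ ≐ ⁅ x ⁆
    X∩x≐x = ⊆-antisym (∩-⊆ʳ X ⁅ x ⁆) λ y y∈x → ∩⁺ X ⁅ x ⁆ (⁅⁆-⊆ x∈X y y∈x) y∈x
    X∩x≡1 : card (X ∩ ⁅ x ⁆) ≡ 1
    X∩x≡1 = trans (card-cong X∩x≐x) (card-⁅⁆ x)

  card≤suc-card∖⁅⁆ : (X : Subset U) (x : Carrier U) → card X ≤ suc (card (X ∖ ⁅ x ⁆))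
  card≤suc-card∖⁅⁆ X x with x ∈?ₛ X
  ... | yes x∈X = ≤-reflexive (card-∖⁅⁆ x∈X)
  ... | no  x∉X = m≤n⇒m≤1+n (card-mono (⊆-∖⁅⁆ ⊆-refl x∉X))

  card-< : {X Y : Subset U} {x : Carrier U} → X ⊆ Y → x ∈ₛ Y → x ∉ₛ X → card X < card Y
  card-< {X} {Y} {x} X⊆Y x∈Y x∉X = begin-strict
    card X                  ≤⟨ card-mono (⊆-∖⁅⁆ X⊆Y x∉X) ⟩
    card (Y ∖ ⁅ x ⁆)        <⟨ n<1+n _ ⟩
    suc (card (Y ∖ ⁅ x ⁆))  ≡⟨ card-∖⁅⁆ x∈Y ⟨
    card Y                  ∎
    where open ≤-Reasoning

  card-∖-∖⁅⁆ : (X : Subset U) (x : Carrier U) → card (X ∖ (X ∖ ⁅ x ⁆)) ≤ 1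
  card-∖-∖⁅⁆ X x = ≤-trans (card-mono only-x) (≤-reflexive (card-⁅⁆ x))
    where
    only-x : X ∖ (X ∖ ⁅ x ⁆) ⊆ ⁅ x ⁆
    only-x y p with y ∈?ₛ ⁅_⁆ {U} x
    ... | yes y∈x = y∈x
    ... | no  y∉x = let y∈X , y∉X∖x = ∖⁻ X (X ∖ ⁅ x ⁆) p in
                    ⊥-elim (y∉X∖x (∖⁺ X ⁅ x ⁆ y∈X y∉x))

  ∖-swap : (X Y Z : Subset U) → (X ∖ Y) ∖ Z ≐ (X ∖ Z) ∖ Y
  ∖-swap X Y Z x = swap (at X x) (at Y x) (at Z x)
    where
    swap : ∀ a b c → (a ∧ not b) ∧ not c ≡ (a ∧ not c) ∧ not b
    swap false _     _     = refl
    swap true  false false = refl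
    swap true  false true  = refl
    swap true  true  false = refl
    swap true  true  true  = refl

  module _ (M : Matroid U) where

    r-cong : {X Y : Subset U} → X ≐ Y → X ⊆ E M → r M X ≡ r M Y
    r-cong X≐Y X⊆E = ≤-antisym (r-mono M _ _ (≐⇒⊆ X≐Y) (⊆-trans (≐⇒⊇ X≐Y) X⊆E))
                               (r-mono M _ _ (≐⇒⊇ X≐Y) X⊆E)

    -- Submodularity twice: once for B and A, once for the disjoint pieces B ∩ A and A ∖ B of A.
    r-∪≤r+card∖ : {A B : Subset U} → A ⊆ E M → B ⊆ E M → r M (B ∪ A) ≤ r M B + card (A ∖ B)
    r-∪≤r+card∖ {A} {B} A⊆E B⊆E = +-cancelʳ-≤ (r M (B ∩ A)) _ _ (begin
      r M (B ∪ A) + r M (B ∩ A)                     ≤⟨ r-sub M B A B⊆E A⊆E ⟩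
      r M B + r M A                                 ≤⟨ +-monoʳ-≤ (r M B) rA≤ ⟩
      r M B + (r M (B ∩ A) + card (A ∖ B))          ≡⟨ cong (r M B +_) (+-comm (r M (B ∩ A)) _) ⟩
      r M B + (card (A ∖ B) + r M (B ∩ A))          ≡⟨ +-assoc (r M B) _ _ ⟨
      r M B + card (A ∖ B) + r M (B ∩ A)            ∎)
      where
      open ≤-Reasoning
      B∩A⊆E : B ∩ A ⊆ E M
      B∩A⊆E = ⊆-trans (∩-⊆ʳ B A) A⊆E
      A∖B⊆E : A ∖ B ⊆ E M
      A∖B⊆E = ⊆-trans (∖-⊆ A B) A⊆E
      pieces : A ≐ (B ∩ A) ∪ (A ∖ B)
      pieces x = split (at A x) (at B x)
        where
        split : ∀ a b → a ≡ (b ∧ a) ∨ (a ∧ not b)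
        split false false = refl
        split false true  = refl
        split true  false = refl
        split true  true  = refl
      rA≤ : r M A ≤ r M (B ∩ A) + card (A ∖ B)
      rA≤ = begin
        r M A                                                      ≡⟨ r-cong pieces A⊆E ⟩
        r M ((B ∩ A) ∪ (A ∖ B))                                    ≤⟨ m≤m+n _ _ ⟩
        r M ((B ∩ A) ∪ (A ∖ B)) + r M ((B ∩ A) ∩ (A ∖ B))         ≤⟨ r-sub M (B ∩ A) (A ∖ B) B∩A⊆E A∖B⊆E ⟩
        r M (B ∩ A) + r M (A ∖ B)                                  ≤⟨ +-monoʳ-≤ (r M (B ∩ A)) (r-card M (A ∖ B) A∖B⊆E) ⟩
        r M (B ∩ A) + card (A ∖ B)                                 ∎

    r≤r+card∖ : {A B : Subset U} → A ⊆ E M → B ⊆ E M → r M A ≤ r M B + card (A ∖ B)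
    r≤r+card∖ {A} {B} A⊆E B⊆E =
      ≤-trans (r-mono M A (B ∪ A) (λ _ → ∪⁺ʳ B A) (∪-⊆ B A B⊆E A⊆E)) (r-∪≤r+card∖ A⊆E B⊆E)

    Cyclic : Subset U → Set
    Cyclic Y = ∀ y → y ∈ₛ Y → r M Y ≤ r M (Y ∖ ⁅ y ⁆)

    Cyclic-cong : {X Y : Subset U} → X ≐ Y → X ⊆ E M → Cyclic X → Cyclic Y
    Cyclic-cong {X} {Y} X≐Y X⊆E cyc y y∈Y = begin
      r M Y                 ≡⟨ r-cong X≐Y X⊆E ⟨
      r M X                 ≤⟨ cyc y (≐⇒⊇ X≐Y y y∈Y) ⟩
      r M (X ∖ ⁅ y ⁆)       ≡⟨ r-cong (∖-congˡ X≐Y) (⊆-trans (∖-⊆ X ⁅ y ⁆) X⊆E) ⟩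
      r M (Y ∖ ⁅ y ⁆)       ∎
      where open ≤-Reasoning

    IsFlat-cong : {X Y : Subset U} → X ≐ Y → IsFlat M X → IsFlat M Y
    IsFlat-cong {X} {Y} X≐Y (X⊆E , grows) = Y⊆E , λ e e∈E e∉Y → begin-strict
      r M Y                 ≡⟨ r-cong X≐Y X⊆E ⟨
      r M X                 <⟨ grows e e∈E (e∉Y ∘ ≐⇒⊆ X≐Y e) ⟩
      r M (X ∪ ⁅ e ⁆)       ≡⟨ r-cong (∪-congˡ X≐Y) (∪-⊆ X ⁅ e ⁆ X⊆E (⁅⁆-⊆ e∈E)) ⟩
      r M (Y ∪ ⁅ e ⁆)       ∎
      where
      open ≤-Reasoning
      Y⊆E : Y ⊆ E M
      Y⊆E = ⊆-trans (≐⇒⊇ X≐Y) X⊆E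

    IsColoop-∣ : {F : Subset U} {e : Carrier U} → F ⊆ E M →
                 IsColoop (M ∣ F) e ⇔ (e ∈ₛ F × r M (F ∖ ⁅ e ⁆) < r M F)
    IsColoop-∣ {F} {e} F⊆E = mk⇔
      (λ (e∈F∩E , drop) → ∩-⊆ˡ F (E M) e e∈F∩E , subst₂ _<_ r-F∖e r-F drop)
      (λ (e∈F , drop) → ∩⁺ F (E M) e∈F (F⊆E e e∈F) , subst₂ _<_ (sym r-F∖e) (sym r-F) drop)
      where
      F∩E≐F : F ∩ E M ≐ F
      F∩E≐F = ⊆⇒∩≐ F⊆E
      r-F : r M (F ∩ E M) ≡ r M F
      r-F = r-cong F∩E≐F (∩-⊆ʳ F (E M))
      r-F∖e : r M ((F ∩ E M) ∖ ⁅ e ⁆) ≡ r M (F ∖ ⁅ e ⁆)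
      r-F∖e = r-cong (∖-congˡ F∩E≐F) (⊆-trans (∖-⊆ (F ∩ E M) ⁅ e ⁆) (∩-⊆ʳ F (E M)))

    cyclicFlat⁺ : {F : Subset U} → IsFlat M F → Cyclic F → IsCyclicFlat M F
    cyclicFlat⁺ flat@(F⊆E , _) cyc = flat , λ e coloop →
      let e∈F , drop = Equivalence.to (IsColoop-∣ F⊆E) coloop in <⇒≱ drop (cyc e e∈F)

    cyclicFlat⁻ : {F : Subset U} → IsCyclicFlat M F → Cyclic F
    cyclicFlat⁻ ((F⊆E , _) , noColoop) y y∈F =
      ≮⇒≥ λ drop → noColoop y (Equivalence.from (IsColoop-∣ F⊆E) (y∈F , drop))

    IsCyclicFlat-cong : {X Y : Subset U} → X ≐ Y → IsCyclicFlat M X → IsCyclicFlat M Y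
    IsCyclicFlat-cong X≐Y cf@(flat@(X⊆E , _) , _) =
      cyclicFlat⁺ (IsFlat-cong X≐Y flat) (Cyclic-cong X≐Y X⊆E (cyclicFlat⁻ cf))

    r<r+card∖-of-Cyclic : {A B : Subset U} {e : Carrier U} → A ⊆ E M → B ⊆ E M → Cyclic A →
                          e ∈ₛ A → e ∉ₛ B → r M A < r M B + card (A ∖ B)
    r<r+card∖-of-Cyclic {A} {B} {e} A⊆E B⊆E cyc e∈A e∉B = begin-strict
      r M A                                 ≤⟨ cyc e e∈A ⟩
      r M (A ∖ ⁅ e ⁆)                       ≤⟨ r≤r+card∖ (⊆-trans (∖-⊆ A ⁅ e ⁆) A⊆E) B⊆E ⟩
      r M B + card ((A ∖ ⁅ e ⁆) ∖ B)        <⟨ +-monoʳ-< (r M B) (card-< (∖-monoˡ (∖-⊆ A ⁅ e ⁆)) (∖⁺ A B e∈A e∉B) e∉A∖e∖B) ⟩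
      r M B + card (A ∖ B)                  ∎
      where
      open ≤-Reasoning
      e∉A∖e∖B : e ∉ₛ (A ∖ ⁅ e ⁆) ∖ B
      e∉A∖e∖B p = ∉∖⁅⁆ A (∖-⊆ (A ∖ ⁅ e ⁆) B e p)

    r<r+card∖-of-IsFlat : {A B : Subset U} {e : Carrier U} → IsFlat M A → B ⊆ E M →
                          e ∈ₛ E M → e ∉ₛ A → e ∈ₛ B → r M A < r M B + card (A ∖ B)
    r<r+card∖-of-IsFlat {A} {B} {e} (A⊆E , grows) B⊆E e∈E e∉A e∈B = begin-strict
      r M A                  <⟨ grows e e∈E e∉A ⟩
      r M (A ∪ ⁅ e ⁆)        ≤⟨ r-mono M (A ∪ ⁅ e ⁆) (B ∪ A) A+e⊆B∪A (∪-⊆ B A B⊆E A⊆E) ⟩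
      r M (B ∪ A)            ≤⟨ r-∪≤r+card∖ A⊆E B⊆E ⟩
      r M B + card (A ∖ B)   ∎
      where
      open ≤-Reasoning
      A+e⊆B∪A : A ∪ ⁅ e ⁆ ⊆ B ∪ A
      A+e⊆B∪A = ∪-⊆ A ⁅ e ⁆ (λ _ → ∪⁺ʳ B A) (⁅⁆-⊆ (∪⁺ˡ B A e∈B))

    -- Adjoin, one at a time, elements that do not raise the rank; this keeps Y cyclic.
    closure-of-Cyclic : {Y : Subset U} → Y ⊆ E M → Cyclic Y →
                        ∃ λ Z → IsCyclicFlat M Z × Y ⊆ Z × r M Z ≤ r M Y
    closure-of-Cyclic Y⊆E cyc = go _ Y⊆E cyc (<-wellFounded _)
      where
      go : ∀ Y → Y ⊆ E M → Cyclic Y → Acc _<_ (card (E M ∖ Y)) →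
           ∃ λ Z → IsCyclicFlat M Z × Y ⊆ Z × r M Z ≤ r M Y
      go Y Y⊆E cyc (acc smaller) with ∃? (λ e → (e ∈?ₛ E M ∖ Y) ×-dec (r M (Y ∪ ⁅ e ⁆) ≤? r M Y))
      ... | no none = Y , cyclicFlat⁺ (Y⊆E , grows) cyc , ⊆-refl , ≤-refl
        where
        grows : ∀ e → e ∈ₛ E M → e ∉ₛ Y → r M Y < r M (Y ∪ ⁅ e ⁆)
        grows e e∈E e∉Y = ≰⇒> λ stays → none (e , ∖⁺ (E M) Y e∈E e∉Y , stays)
      ... | yes (e , e∈E∖Y , stays) =
        let Z , cfZ , Y+e⊆Z , rZ≤ = go (Y ∪ ⁅ e ⁆) Y+e⊆E cyc+e (smaller fewer)
        in  Z , cfZ , ⊆-trans (λ _ → ∪⁺ˡ Y ⁅ e ⁆) Y+e⊆Z , ≤-trans rZ≤ stays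
        where
        e∈E = proj₁ (∖⁻ (E M) Y e∈E∖Y)
        Y+e⊆E : Y ∪ ⁅ e ⁆ ⊆ E M
        Y+e⊆E = ∪-⊆ Y ⁅ e ⁆ Y⊆E (⁅⁆-⊆ e∈E)
        rY≤ : ∀ y → r M Y ≤ r M ((Y ∪ ⁅ e ⁆) ∖ ⁅ y ⁆)
        rY≤ y with y ∈?ₛ Y
        ... | yes y∈Y = ≤-trans (cyc y y∈Y) (r-mono M _ _ (∖-monoˡ (λ _ → ∪⁺ˡ Y ⁅ e ⁆)) Y+e∖y⊆E)
          where Y+e∖y⊆E = ⊆-trans (∖-⊆ (Y ∪ ⁅ e ⁆) ⁅ y ⁆) Y+e⊆E
        ... | no  y∉Y = r-mono M _ _ (⊆-∖⁅⁆ (λ _ → ∪⁺ˡ Y ⁅ e ⁆) y∉Y) Y+e∖y⊆E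
          where Y+e∖y⊆E = ⊆-trans (∖-⊆ (Y ∪ ⁅ e ⁆) ⁅ y ⁆) Y+e⊆E
        cyc+e : Cyclic (Y ∪ ⁅ e ⁆)
        cyc+e y _ = ≤-trans stays (rY≤ y)
        fewer : card (E M ∖ (Y ∪ ⁅ e ⁆)) < card (E M ∖ Y)
        fewer = card-< (∖-monoʳ (λ _ → ∪⁺ˡ Y ⁅ e ⁆)) e∈E∖Y
                       (λ e∈E∖Y+e → proj₂ (∖⁻ (E M) (Y ∪ ⁅ e ⁆) e∈E∖Y+e) (∪⁅⁆⁺ Y))

    -- Delete, one at a time, elements whose removal lowers the rank; then close up.
    cyclicFlat-dominating : {Y : Subset U} → Y ⊆ E M →
                            ∃ λ Z → IsCyclicFlat M Z × r M Z + card (Y ∖ Z) ≤ r M Y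
    cyclicFlat-dominating Y⊆E = go _ Y⊆E (<-wellFounded _)
      where
      go : ∀ Y → Y ⊆ E M → Acc _<_ (card Y) → ∃ λ Z → IsCyclicFlat M Z × r M Z + card (Y ∖ Z) ≤ r M Y
      go Y Y⊆E (acc smaller) with ∃? (λ y → (y ∈?ₛ Y) ×-dec (r M (Y ∖ ⁅ y ⁆) <? r M Y))
      ... | no none =
        let Z , cfZ , Y⊆Z , rZ≤ = closure-of-Cyclic Y⊆E (λ y y∈Y → ≮⇒≥ λ drop → none (y , y∈Y , drop))
        in  Z , cfZ , ≤-trans (≤-reflexive (trans (cong (r M Z +_) (card-∖-⊆ Y⊆Z)) (+-identityʳ _))) rZ≤
      ... | yes (y , y∈Y , drop)
            with go (Y ∖ ⁅ y ⁆) (⊆-trans (∖-⊆ Y ⁅ y ⁆) Y⊆E) (smaller (card-< (∖-⊆ Y ⁅ y ⁆) y∈Y (∉∖⁅⁆ Y)))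
      ...   | Z , cfZ , bound = Z , cfZ , (begin
        r M Z + card (Y ∖ Z)                      ≤⟨ +-monoʳ-≤ (r M Z) (card≤suc-card∖⁅⁆ (Y ∖ Z) y) ⟩
        r M Z + suc (card ((Y ∖ Z) ∖ ⁅ y ⁆))      ≡⟨ cong (λ k → r M Z + suc k) (card-cong (∖-swap Y Z ⁅ y ⁆)) ⟩
        r M Z + suc (card ((Y ∖ ⁅ y ⁆) ∖ Z))      ≡⟨ +-suc (r M Z) _ ⟩
        suc (r M Z + card ((Y ∖ ⁅ y ⁆) ∖ Z))      ≤⟨ s≤s bound ⟩
        suc (r M (Y ∖ ⁅ y ⁆))                     ≤⟨ drop ⟩
        r M Y                                     ∎)
        where open ≤-Reasoning

m≤n+o⇒m∸p≤n∸p+o : ∀ {m n o p} → p ≤ n → m ≤ n + o → m ∸ p ≤ n ∸ p + o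
m≤n+o⇒m∸p≤n∸p+o {m} {n} {o} {p} p≤n m≤n+o = begin
  m ∸ p        ≤⟨ ∸-monoˡ-≤ p m≤n+o ⟩
  n + o ∸ p    ≡⟨ +-∸-comm o p≤n ⟩
  n ∸ p + o    ∎
  where open ≤-Reasoning

m+o≤n⇒m∸p+o≤n∸p : ∀ {m n o p} → p ≤ m → m + o ≤ n → m ∸ p + o ≤ n ∸ p
m+o≤n⇒m∸p+o≤n∸p {m} {n} {o} {p} p≤m m+o≤n = begin
  m ∸ p + o    ≡⟨ +-∸-comm o p≤m ⟨
  m + o ∸ p    ≤⟨ ∸-monoˡ-≤ p m+o≤n ⟩
  n ∸ p        ∎
  where open ≤-Reasoning

enumFin : ∀ n → IsEnumerated (FinU n)
enumFin n = record { complete = ∈-allFin ; unique = allFin⁺ n }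

enumProd : ∀ n t → IsEnumerated (ProdU n t)
enumProd n t = record
  { complete = λ (e , i) → ∈-cartesianProduct⁺ (∈-allFin e) (∈-allFin i)
  ; unique   = cartesianProduct⁺ (allFin⁺ n) (allFin⁺ t)
  }

card-S : ∀ {n} t (A : Subset (FinU n)) → card (S t A) ≡ t * card A
card-S {n} t A = begin
  card (S t A)                                                       ≡⟨ card≡count (S t A) ⟩
  count (λ p → at A (proj₁ p)) (cartesianProduct (allFin n) (allFin t)) ≡⟨ count-cartesianProduct (at A) (allFin n) (allFin t) ⟩
  length (allFin t) * count (at A) (allFin n)                        ≡⟨ cong₂ _*_ (length-tabulate {n = t} id) (sym (card≡count A)) ⟩
  t * card A                                                         ∎
  where open ≡-Reasoning

Fin? : ∀ t → Dec (Fin t)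
Fin? zero    = no λ ()
Fin? (suc t) = yes Data.Fin.zero

*-monoʳ-<-Fin : ∀ {t a b} → Fin t → a < b → t * a < t * b
*-monoʳ-<-Fin {suc t} _ = *-monoʳ-< (suc t)

module _ {n : ℕ} (t : ℕ) where
  private
    module F = Finite (enumFin n)
    module P = Finite (enumProd n t)

  record ExpandedRank (M : Matroid (FinU n)) (N : Matroid (ProdU n t)) : Set where
    field
      ground     : E N ≐ S t (E M)
      r-≤        : ∀ Y B → Y ⊆ E N → B ⊆ E M → r N Y ≤ t * r M B + card (Y ∖ S t B)
      r-attained : ∀ Y → Y ⊆ E N → ∃ λ B → B ⊆ E M × t * r M B + card (Y ∖ S t B) ≤ r N Y

  S-mono : {A B : Subset (FinU n)} → A ⊆ B → S t A ⊆ S t B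
  S-mono A⊆B (e , _) = A⊆B e

  t*r≤t*r+card∖S : (M : Matroid (FinU n)) {A B : Subset (FinU n)} → A ⊆ E M → B ⊆ E M →
                   t * r M A ≤ t * r M B + card (S t A ∖ S t B)
  t*r≤t*r+card∖S M {A} {B} A⊆E B⊆E = begin
    t * r M A                       ≤⟨ *-monoʳ-≤ t (F.r≤r+card∖ M A⊆E B⊆E) ⟩
    t * (r M B + card (A ∖ B))      ≡⟨ *-distribˡ-+ t (r M B) _ ⟩
    t * r M B + t * card (A ∖ B)    ≡⟨ cong (t * r M B +_) (card-S t (A ∖ B)) ⟨
    t * r M B + card (S t A ∖ S t B) ∎
    where open ≤-Reasoning

  t*r<t*r+card∖S : (M : Matroid (FinU n)) {A B : Subset (FinU n)} → Fin t →
                   r M A < r M B + card (A ∖ B) → t * r M A < t * r M B + card (S t A ∖ S t B)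
  t*r<t*r+card∖S M {A} {B} i lt = begin-strict
    t * r M A                       <⟨ *-monoʳ-<-Fin i lt ⟩
    t * (r M B + card (A ∖ B))      ≡⟨ *-distribˡ-+ t (r M B) _ ⟩
    t * r M B + t * card (A ∖ B)    ≡⟨ cong (t * r M B +_) (card-S t (A ∖ B)) ⟨
    t * r M B + card (S t A ∖ S t B) ∎
    where open ≤-Reasoning

  module _ {M : Matroid (FinU n)} {N : Matroid (ProdU n t)} where

    S⊆E : E N ≐ S t (E M) → {B : Subset (FinU n)} → B ⊆ E M → S t B ⊆ E N
    S⊆E ground B⊆E = P.⊆-trans (S-mono B⊆E) (P.≐⇒⊇ ground)

    -- The bound goes through a cyclic flat Z dominating B, where r_N(S_Z) = t·r_M(Z)
    -- is given; the minimum is attained at A with S_A a cyclic flat dominating Y.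
    IsExpansion⇒ExpandedRank : IsExpansion t M N → ExpandedRank M N
    IsExpansion⇒ExpandedRank (ground , cyclicFlats , r-S) = record
      { ground = ground ; r-≤ = upper ; r-attained = attained }
      where
      upper : ∀ Y B → Y ⊆ E N → B ⊆ E M → r N Y ≤ t * r M B + card (Y ∖ S t B)
      upper Y B Y⊆E B⊆E with F.cyclicFlat-dominating M B⊆E
      ... | Z , cfZ , bound = begin
        r N Y                                              ≤⟨ P.r≤r+card∖ N Y⊆E SZ⊆E ⟩
        r N (S t Z) + card (Y ∖ S t Z)                     ≡⟨ cong (_+ card (Y ∖ S t Z)) (r-S Z cfZ) ⟩
        t * r M Z + card (Y ∖ S t Z)                       ≤⟨ +-monoʳ-≤ (t * r M Z) (P.card-∖-triangle Y (S t B) (S t Z)) ⟩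
        t * r M Z + (card (Y ∖ S t B) + card (S t B ∖ S t Z)) ≡⟨ cong (λ k → t * r M Z + (card (Y ∖ S t B) + k)) (card-S t (B ∖ Z)) ⟩
        t * r M Z + (card (Y ∖ S t B) + t * card (B ∖ Z))  ≡⟨ rearrange (t * r M Z) (card (Y ∖ S t B)) _ ⟩
        t * r M Z + t * card (B ∖ Z) + card (Y ∖ S t B)    ≡⟨ cong (_+ card (Y ∖ S t B)) (*-distribˡ-+ t (r M Z) _) ⟨
        t * (r M Z + card (B ∖ Z)) + card (Y ∖ S t B)      ≤⟨ +-monoˡ-≤ _ (*-monoʳ-≤ t bound) ⟩
        t * r M B + card (Y ∖ S t B)                       ∎
        where
        open ≤-Reasoning
        SZ⊆E : S t Z ⊆ E N
        SZ⊆E = S⊆E ground (proj₁ (proj₁ cfZ))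
        rearrange : ∀ a b c → a + (b + c) ≡ a + c + b
        rearrange a b c = trans (cong (a +_) (+-comm b c)) (sym (+-assoc a c b))
      attained : ∀ Y → Y ⊆ E N → ∃ λ B → B ⊆ E M × t * r M B + card (Y ∖ S t B) ≤ r N Y
      attained Y Y⊆E with P.cyclicFlat-dominating N Y⊆E
      ... | Z , cfZ , bound with Equivalence.to (cyclicFlats Z) cfZ
      ...   | A , cfA , Z≐SA = A , proj₁ (proj₁ cfA) , (begin
        t * r M A + card (Y ∖ S t A)   ≡⟨ cong₂ _+_ (r-S A cfA) (P.card-cong (P.∖-congʳ Z≐SA)) ⟨
        r N (S t A) + card (Y ∖ Z)     ≡⟨ cong (_+ card (Y ∖ Z)) (P.r-cong N Z≐SA (proj₁ (proj₁ cfZ))) ⟨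
        r N Z + card (Y ∖ Z)           ≤⟨ bound ⟩
        r N Y                          ∎)
        where open ≤-Reasoning

    module _ (ρ : ExpandedRank M N) where
      open ExpandedRank ρ

      r-S : {B : Subset (FinU n)} → B ⊆ E M → r N (S t B) ≡ t * r M B
      r-S {B} B⊆E with r-attained (S t B) (S⊆E ground B⊆E)
      ... | B′ , B′⊆E , tight = ≤-antisym (begin
        r N (S t B)                      ≤⟨ r-≤ (S t B) B SB⊆E B⊆E ⟩
        t * r M B + card (S t B ∖ S t B)  ≡⟨ cong (t * r M B +_) (P.card-∖-⊆ (P.⊆-refl {S t B})) ⟩
        t * r M B + 0                    ≡⟨ +-identityʳ _ ⟩
        t * r M B                        ∎)
        (≤-trans (t*r≤t*r+card∖S M B⊆E B′⊆E) tight)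
        where
        open ≤-Reasoning
        SB⊆E : S t B ⊆ E N
        SB⊆E = S⊆E ground B⊆E

      S-IsFlat : {A : Subset (FinU n)} → IsFlat M A → IsFlat N (S t A)
      S-IsFlat {A} flat@(A⊆E , _) = SA⊆E , grows
        where
        SA⊆E : S t A ⊆ E N
        SA⊆E = S⊆E ground A⊆E
        grows : ∀ p → p ∈ₛ E N → p ∉ₛ S t A → r N (S t A) < r N (S t A ∪ ⁅ p ⁆)
        grows p@(e , i) p∈E p∉SA
          with r-attained (S t A ∪ ⁅ p ⁆) (∪-⊆ (S t A) ⁅ p ⁆ SA⊆E (P.⁅⁆-⊆ p∈E))
        ... | B , B⊆E , tight = begin-strict
          r N (S t A)                                  ≡⟨ r-S A⊆E ⟩
          t * r M A                                    <⟨ below (e ∈?ₛ B) ⟩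
          t * r M B + card ((S t A ∪ ⁅ p ⁆) ∖ S t B)   ≤⟨ tight ⟩
          r N (S t A ∪ ⁅ p ⁆)                          ∎
          where
          open ≤-Reasoning
          SA∖SB⊆ : S t A ∖ S t B ⊆ (S t A ∪ ⁅ p ⁆) ∖ S t B
          SA∖SB⊆ = P.∖-monoˡ (λ _ → ∪⁺ˡ (S t A) ⁅ p ⁆)
          below : Dec (e ∈ₛ B) → t * r M A < t * r M B + card ((S t A ∪ ⁅ p ⁆) ∖ S t B)
          below (yes e∈B) = <-≤-trans
            (t*r<t*r+card∖S M i (F.r<r+card∖-of-IsFlat M flat B⊆E (P.≐⇒⊆ ground p p∈E) p∉SA e∈B))
            (+-monoʳ-≤ (t * r M B) (P.card-mono SA∖SB⊆))
          below (no e∉B) = ≤-<-trans (t*r≤t*r+card∖S M A⊆E B⊆E)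
            (+-monoʳ-< (t * r M B) (P.card-< SA∖SB⊆ (∖⁺ (S t A ∪ ⁅ p ⁆) (S t B) (∪⁅⁆⁺ (S t A) {p}) e∉B)
                                               λ q → p∉SA (proj₁ (∖⁻ (S t A) (S t B) {p} q))))

      S-Cyclic : {A : Subset (FinU n)} → A ⊆ E M → F.Cyclic M A → P.Cyclic N (S t A)
      S-Cyclic {A} A⊆E cyc p@(e , i) e∈A
        with r-attained (S t A ∖ ⁅ p ⁆) (P.⊆-trans (∖-⊆ (S t A) ⁅ p ⁆) (S⊆E ground A⊆E))
      ... | B , B⊆E , tight = begin
        r N (S t A)                                   ≡⟨ r-S A⊆E ⟩
        t * r M A                                     ≤⟨ above (e ∈?ₛ B) ⟩
        t * r M B + card ((S t A ∖ ⁅ p ⁆) ∖ S t B)    ≤⟨ tight ⟩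
        r N (S t A ∖ ⁅ p ⁆)                           ∎
        where
        open ≤-Reasoning
        above : Dec (e ∈ₛ B) → t * r M A ≤ t * r M B + card ((S t A ∖ ⁅ p ⁆) ∖ S t B)
        above (yes e∈B) = ≤-trans (t*r≤t*r+card∖S M A⊆E B⊆E) (+-monoʳ-≤ (t * r M B) (P.card-mono SA∖SB⊆))
          where
          SA∖SB⊆ : S t A ∖ S t B ⊆ (S t A ∖ ⁅ p ⁆) ∖ S t B
          SA∖SB⊆ q q∈SA∖SB = let q∈SA , q∉SB = ∖⁻ (S t A) (S t B) {q} q∈SA∖SB in
            ∖⁺ (S t A ∖ ⁅ p ⁆) (S t B) (∖⁅⁆⁺ (S t A) q∈SA λ { refl → q∉SB e∈B }) q∉SB
        above (no e∉B) = ≤-pred (begin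
          suc (t * r M A)                                       ≤⟨ t*r<t*r+card∖S M i (F.r<r+card∖-of-Cyclic M A⊆E B⊆E cyc e∈A e∉B) ⟩
          t * r M B + card (S t A ∖ S t B)                      ≤⟨ +-monoʳ-≤ (t * r M B) (P.card≤suc-card∖⁅⁆ (S t A ∖ S t B) p) ⟩
          t * r M B + suc (card ((S t A ∖ S t B) ∖ ⁅ p ⁆))      ≡⟨ cong (λ k → t * r M B + suc k) (P.card-cong (P.∖-swap (S t A) (S t B) ⁅ p ⁆)) ⟩
          t * r M B + suc (card ((S t A ∖ ⁅ p ⁆) ∖ S t B))      ≡⟨ +-suc (t * r M B) _ ⟩
          suc (t * r M B + card ((S t A ∖ ⁅ p ⁆) ∖ S t B))      ∎)

      S-IsCyclicFlat : {A : Subset (FinU n)} → IsCyclicFlat M A → IsCyclicFlat N (S t A)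
      S-IsCyclicFlat cfA@(flat@(A⊆E , _) , _) =
        P.cyclicFlat⁺ N (S-IsFlat flat) (S-Cyclic A⊆E (F.cyclicFlat⁻ M cfA))

      -- For t = 0 the ground set of N is empty and any cyclic flat of M will do.
      -- Otherwise take B attaining r_N(F): cyclicity of F forces F ⊆ S_B, flatness
      -- forces S_B ⊆ F, and both properties then descend from S_B to B.
      IsCyclicFlat⇒≐S : {F : Subset (ProdU n t)} → IsCyclicFlat N F →
                          ∃ λ A → IsCyclicFlat M A × F ≐ S t A
      IsCyclicFlat⇒≐S {F} cfF with Fin? t
      ... | no ¬i = let A , cfA , _ = F.cyclicFlat-dominating M (F.⊆-refl {E M}) in
                    A , cfA , λ (_ , i) → ⊥-elim (¬i i)
      ... | yes i with r-attained F (proj₁ (proj₁ cfF))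
      ...   | B , B⊆E , tight = B , F.cyclicFlat⁺ M B-flat B-cyclic , F≐SB
        where
        open ≤-Reasoning
        F⊆E : F ⊆ E N
        F⊆E = proj₁ (proj₁ cfF)
        grows : ∀ p → p ∈ₛ E N → p ∉ₛ F → r N F < r N (F ∪ ⁅ p ⁆)
        grows = proj₂ (proj₁ cfF)
        cycF : P.Cyclic N F
        cycF = P.cyclicFlat⁻ N cfF
        SB⊆E : S t B ⊆ E N
        SB⊆E = S⊆E ground B⊆E
        F∖p⊆E : ∀ p → F ∖ ⁅ p ⁆ ⊆ E N
        F∖p⊆E p = P.⊆-trans (∖-⊆ F ⁅ p ⁆) F⊆E
        t*rB≤rF : t * r M B ≤ r N F
        t*rB≤rF = ≤-trans (m≤m+n _ _) tight

        F⊆SB : F ⊆ S t B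
        F⊆SB p p∈F with p ∈?ₛ S t B
        ... | yes p∈SB = p∈SB
        ... | no  p∉SB = ⊥-elim (<⇒≱ (begin-strict
          r N (F ∖ ⁅ p ⁆)                       ≤⟨ r-≤ (F ∖ ⁅ p ⁆) B (F∖p⊆E p) B⊆E ⟩
          t * r M B + card ((F ∖ ⁅ p ⁆) ∖ S t B)  <⟨ +-monoʳ-< (t * r M B) (P.card-< (P.∖-monoˡ (∖-⊆ F ⁅ p ⁆))
                                                     (∖⁺ F (S t B) p∈F p∉SB) (λ q → ∉∖⁅⁆ F (∖-⊆ (F ∖ ⁅ p ⁆) (S t B) p q))) ⟩
          t * r M B + card (F ∖ S t B)          ≤⟨ tight ⟩
          r N F                                 ∎) (cycF p p∈F))

        SB⊆F : S t B ⊆ F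
        SB⊆F p p∈SB with p ∈?ₛ F
        ... | yes p∈F = p∈F
        ... | no  p∉F = ⊥-elim (<⇒≱ (grows p (SB⊆E p p∈SB) p∉F) (begin
          r N (F ∪ ⁅ p ⁆)   ≤⟨ r-mono N _ _ (∪-⊆ F ⁅ p ⁆ F⊆SB (P.⁅⁆-⊆ p∈SB)) SB⊆E ⟩
          r N (S t B)       ≡⟨ r-S B⊆E ⟩
          t * r M B         ≤⟨ t*rB≤rF ⟩
          r N F             ∎))

        F≐SB : F ≐ S t B
        F≐SB = P.⊆-antisym F⊆SB SB⊆F

        B-flat : IsFlat M B
        B-flat = B⊆E , λ e e∈E e∉B → ≰⇒> λ stays →
          let p = e , i
              B+e⊆E = ∪-⊆ B ⁅ e ⁆ B⊆E (F.⁅⁆-⊆ e∈E)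
          in <⇒≱ (grows p (P.≐⇒⊇ ground p e∈E) (e∉B ∘ F⊆SB p)) (begin
            r N (F ∪ ⁅ p ⁆)      ≤⟨ r-mono N _ _ (∪-⊆ F ⁅ p ⁆ (P.⊆-trans F⊆SB (S-mono (λ _ → ∪⁺ˡ B ⁅ e ⁆)))
                                                               (P.⁅⁆-⊆ (∪⁅⁆⁺ B {e})))
                                                 (S⊆E ground B+e⊆E) ⟩
            r N (S t (B ∪ ⁅ e ⁆)) ≡⟨ r-S B+e⊆E ⟩
            t * r M (B ∪ ⁅ e ⁆)   ≤⟨ *-monoʳ-≤ t stays ⟩
            t * r M B            ≤⟨ t*rB≤rF ⟩
            r N F                ∎)

        B-cyclic : F.Cyclic M B
        B-cyclic y y∈B = ≮⇒≥ λ drop →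
          let p = y , i
              B∖y⊆E = F.⊆-trans (∖-⊆ B ⁅ y ⁆) B⊆E
          in <⇒≱ (begin-strict
            r N (F ∖ ⁅ p ⁆)                                 ≤⟨ r-≤ (F ∖ ⁅ p ⁆) (B ∖ ⁅ y ⁆) (F∖p⊆E p) B∖y⊆E ⟩
            t * r M (B ∖ ⁅ y ⁆) + card ((F ∖ ⁅ p ⁆) ∖ S t (B ∖ ⁅ y ⁆))
                                                            <⟨ +-monoʳ-< _ (P.card-< (P.∖-monoˡ (∖-⊆ F ⁅ p ⁆))
                                                                 (∖⁺ F (S t (B ∖ ⁅ y ⁆)) (SB⊆F p y∈B) (∉∖⁅⁆ B))
                                                                 (λ q → ∉∖⁅⁆ F (∖-⊆ (F ∖ ⁅ p ⁆) (S t (B ∖ ⁅ y ⁆)) p q))) ⟩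
            t * r M (B ∖ ⁅ y ⁆) + card (F ∖ S t (B ∖ ⁅ y ⁆))  ≤⟨ +-monoʳ-≤ _ (card-F∖S[B∖y] y) ⟩
            t * r M (B ∖ ⁅ y ⁆) + t                         ≡⟨ trans (+-comm _ t) (sym (*-suc t _)) ⟩
            t * suc (r M (B ∖ ⁅ y ⁆))                       ≤⟨ *-monoʳ-≤ t drop ⟩
            t * r M B                                       ≤⟨ t*rB≤rF ⟩
            r N F                                           ∎) (cycF p (SB⊆F p y∈B))
          where
          card-F∖S[B∖y] : ∀ y → card (F ∖ S t (B ∖ ⁅ y ⁆)) ≤ t
          card-F∖S[B∖y] y = begin
            card (F ∖ S t (B ∖ ⁅ y ⁆))          ≤⟨ P.card-mono (P.∖-monoˡ F⊆SB) ⟩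
            card (S t (B ∖ (B ∖ ⁅ y ⁆)))        ≡⟨ card-S t (B ∖ (B ∖ ⁅ y ⁆)) ⟩
            t * card (B ∖ (B ∖ ⁅ y ⁆))          ≤⟨ *-monoʳ-≤ t (F.card-∖-∖⁅⁆ B y) ⟩
            t * 1                               ≡⟨ *-identityʳ t ⟩
            t                                   ∎

      ExpandedRank⇒IsExpansion : IsExpansion t M N
      ExpandedRank⇒IsExpansion =
        ground ,
        (λ F → mk⇔ IsCyclicFlat⇒≐S λ (A , cfA , F≐SA) →
                     P.IsCyclicFlat-cong N (P.≐-sym F≐SA) (S-IsCyclicFlat cfA)) ,
        λ A cfA → r-S (proj₁ (proj₁ cfA))

  ExpandedRank-∣ : {M : Matroid (FinU n)} {N : Matroid (ProdU n t)} (X : Subset (FinU n)) →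
                   ExpandedRank M N → ExpandedRank (M ∣ X) (N ∣ S t X)
  ExpandedRank-∣ {M} {N} X ρ = record
    { ground     = λ p → cong (at X (proj₁ p) ∧_) (ground p)
    ; r-≤        = λ Y B Y⊆ B⊆ → r-≤ Y B (P.⊆-trans Y⊆ (∩-⊆ʳ (S t X) (E N)))
                                         (F.⊆-trans B⊆ (∩-⊆ʳ X (E M)))
    ; r-attained = attained
    }
    where
    open ExpandedRank ρ
    attained : ∀ Y → Y ⊆ S t X ∩ E N → ∃ λ B → B ⊆ X ∩ E M × t * r M B + card (Y ∖ S t B) ≤ r N Y
    attained Y Y⊆ with r-attained Y (P.⊆-trans Y⊆ (∩-⊆ʳ (S t X) (E N)))
    ... | B , B⊆E , tight = B ∩ X , B∩X⊆ ,
      ≤-trans (+-mono-≤ (*-monoʳ-≤ t (r-mono M (B ∩ X) B (∩-⊆ˡ B X) B⊆E)) (P.card-mono Y∖S[B∩X]⊆Y∖SB)) tight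
      where
      B∩X⊆ : B ∩ X ⊆ X ∩ E M
      B∩X⊆ e e∈B∩X = let e∈B , e∈X = ∩⁻ B X e∈B∩X in ∩⁺ X (E M) e∈X (B⊆E e e∈B)
      Y∖S[B∩X]⊆Y∖SB : Y ∖ S t (B ∩ X) ⊆ Y ∖ S t B
      Y∖S[B∩X]⊆Y∖SB p p∈ = let p∈Y , p∉S[B∩X] = ∖⁻ Y (S t (B ∩ X)) {p} p∈ in
        ∖⁺ Y (S t B) p∈Y λ p∈SB → p∉S[B∩X] (∩⁺ B X p∈SB (∩-⊆ˡ (S t X) (E N) p (Y⊆ p p∈Y)))

  -- Y ⊆ E(N) − S_X: bound and attain the rank of Y ∪ S_X, then subtract r_N(S_X) = t·r_M(X).
  ExpandedRank-/ : {M : Matroid (FinU n)} {N : Matroid (ProdU n t)} (X : Subset (FinU n)) →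
                   ExpandedRank M N → ExpandedRank (M / X) (N / S t X)
  ExpandedRank-/ {M} {N} X ρ = record
    { ground     = λ p → cong (_∧ not (at X (proj₁ p))) (ground p)
    ; r-≤        = upper
    ; r-attained = attained
    }
    where
    open ExpandedRank ρ
    X′ = X ∩ E M
    SX′ = S t X ∩ E N
    X′⊆E : X′ ⊆ E M
    X′⊆E = ∩-⊆ʳ X (E M)
    SX′≐S[X′] : SX′ ≐ S t X′
    SX′≐S[X′] p = cong (at X (proj₁ p) ∧_) (ground p)
    r-SX′ : r N SX′ ≡ t * r M X′
    r-SX′ = trans (P.r-cong N SX′≐S[X′] (∩-⊆ʳ (S t X) (E N))) (r-S ρ X′⊆E)
    r[SX′]≤ : ∀ {B : Subset (FinU n)} → B ⊆ E M → r N SX′ ≤ t * r M (B ∪ X′)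
    r[SX′]≤ {B} B⊆E = ≤-trans (≤-reflexive r-SX′)
                              (*-monoʳ-≤ t (r-mono M X′ (B ∪ X′) (λ _ → ∪⁺ʳ B X′) (∪-⊆ B X′ B⊆E X′⊆E)))
    Y∪SX′⊆E : ∀ {Y : Subset (ProdU n t)} → Y ⊆ E N ∖ S t X → Y ∪ SX′ ⊆ E N
    Y∪SX′⊆E {Y} Y⊆ = ∪-⊆ Y SX′ (P.⊆-trans Y⊆ (∖-⊆ (E N) (S t X))) (∩-⊆ʳ (S t X) (E N))
    t*[r∸r] : ∀ B → t * (r M (B ∪ X′) ∸ r M X′) ≡ t * r M (B ∪ X′) ∸ r N SX′
    t*[r∸r] B = trans (*-distribˡ-∸ t (r M (B ∪ X′)) (r M X′)) (cong (t * r M (B ∪ X′) ∸_) (sym r-SX′))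

    upper : ∀ Y B → Y ⊆ E N ∖ S t X → B ⊆ E M ∖ X →
            r N (Y ∪ SX′) ∸ r N SX′ ≤ t * (r M (B ∪ X′) ∸ r M X′) + card (Y ∖ S t B)
    upper Y B Y⊆ B⊆ = begin
      r N (Y ∪ SX′) ∸ r N SX′                         ≤⟨ m≤n+o⇒m∸p≤n∸p+o (r[SX′]≤ B⊆E) bound ⟩
      t * r M (B ∪ X′) ∸ r N SX′ + card (Y ∖ S t B)   ≡⟨ cong (_+ card (Y ∖ S t B)) (t*[r∸r] B) ⟨
      t * (r M (B ∪ X′) ∸ r M X′) + card (Y ∖ S t B)  ∎
      where
      open ≤-Reasoning
      B⊆E : B ⊆ E M
      B⊆E = F.⊆-trans B⊆ (∖-⊆ (E M) X)
      shrink : (Y ∪ SX′) ∖ S t (B ∪ X′) ⊆ Y ∖ S t B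
      shrink p p∈ with ∖⁻ (Y ∪ SX′) (S t (B ∪ X′)) {p} p∈
      ... | p∈Y∪SX′ , p∉S[B∪X′] with ∪⁻ Y SX′ p∈Y∪SX′
      ...   | inj₁ p∈Y   = ∖⁺ Y (S t B) p∈Y (p∉S[B∪X′] ∘ ∪⁺ˡ B X′)
      ...   | inj₂ p∈SX′ = ⊥-elim (p∉S[B∪X′] (∪⁺ʳ B X′ (P.≐⇒⊆ SX′≐S[X′] p p∈SX′)))
      bound : r N (Y ∪ SX′) ≤ t * r M (B ∪ X′) + card (Y ∖ S t B)
      bound = begin
        r N (Y ∪ SX′)                                       ≤⟨ r-≤ (Y ∪ SX′) (B ∪ X′) (Y∪SX′⊆E Y⊆) (∪-⊆ B X′ B⊆E X′⊆E) ⟩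
        t * r M (B ∪ X′) + card ((Y ∪ SX′) ∖ S t (B ∪ X′))  ≤⟨ +-monoʳ-≤ _ (P.card-mono shrink) ⟩
        t * r M (B ∪ X′) + card (Y ∖ S t B)                 ∎

    attained : ∀ Y → Y ⊆ E N ∖ S t X →
               ∃ λ B → B ⊆ E M ∖ X ×
                 t * (r M (B ∪ X′) ∸ r M X′) + card (Y ∖ S t B) ≤ r N (Y ∪ SX′) ∸ r N SX′
    attained Y Y⊆ with r-attained (Y ∪ SX′) (Y∪SX′⊆E Y⊆)
    ... | B , B⊆E , tight = B ∖ X , B∖X⊆ , (begin
      t * (r M ((B ∖ X) ∪ X′) ∸ r M X′) + card (Y ∖ S t (B ∖ X))  ≡⟨ cong (_+ card (Y ∖ S t (B ∖ X))) (t*[r∸r] (B ∖ X)) ⟩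
      t * r M ((B ∖ X) ∪ X′) ∸ r N SX′ + card (Y ∖ S t (B ∖ X))   ≤⟨ m+o≤n⇒m∸p+o≤n∸p (r[SX′]≤ (F.⊆-trans (∖-⊆ B X) B⊆E)) bound ⟩
      r N (Y ∪ SX′) ∸ r N SX′                                     ∎)
      where
      open ≤-Reasoning
      B∖X⊆ : B ∖ X ⊆ E M ∖ X
      B∖X⊆ = F.∖-monoˡ B⊆E
      Y∩SX=∅ : ∀ p → p ∈ₛ Y → proj₁ p ∉ₛ X
      Y∩SX=∅ p p∈Y = proj₂ (∖⁻ (E N) (S t X) {p} (Y⊆ p p∈Y))
      r[B∖X∪X′]≤ : r M ((B ∖ X) ∪ X′) ≤ r M B + card (X′ ∖ B)
      r[B∖X∪X′]≤ = ≤-trans (r-mono M _ (B ∪ X′) (F.∪-monoˡ (∖-⊆ B X)) (∪-⊆ B X′ B⊆E X′⊆E))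
                           (F.r-∪≤r+card∖ M X′⊆E B⊆E)
      Y∖S[B∖X]⊆ : Y ∖ S t (B ∖ X) ⊆ Y ∖ S t B
      Y∖S[B∖X]⊆ p p∈ = let p∈Y , p∉S[B∖X] = ∖⁻ Y (S t (B ∖ X)) {p} p∈ in
        ∖⁺ Y (S t B) p∈Y λ p∈SB → p∉S[B∖X] (∖⁺ B X p∈SB (Y∩SX=∅ p p∈Y))
      split : t * card (X′ ∖ B) + card (Y ∖ S t B) ≤ card ((Y ∪ SX′) ∖ S t B)
      split = subst (λ k → k + card (Y ∖ S t B) ≤ card ((Y ∪ SX′) ∖ S t B)) (card-S t (X′ ∖ B))
        (P.card-disjoint-≤ (P.∖-monoˡ (λ p p∈ → ∪⁺ʳ Y SX′ (P.≐⇒⊇ SX′≐S[X′] p p∈)))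
                           (P.∖-monoˡ (λ _ → ∪⁺ˡ Y SX′))
                           λ p p∈Y∖SB p∈SX′∖SB → Y∩SX=∅ p (proj₁ (∖⁻ Y (S t B) {p} p∈Y∖SB))
                                                       (∩-⊆ˡ X (E M) (proj₁ p) (proj₁ (∖⁻ (S t X′) (S t B) {p} p∈SX′∖SB))))
      bound : t * r M ((B ∖ X) ∪ X′) + card (Y ∖ S t (B ∖ X)) ≤ r N (Y ∪ SX′)
      bound = begin
        t * r M ((B ∖ X) ∪ X′) + card (Y ∖ S t (B ∖ X))     ≤⟨ +-mono-≤ (*-monoʳ-≤ t r[B∖X∪X′]≤) (P.card-mono Y∖S[B∖X]⊆) ⟩
        t * (r M B + card (X′ ∖ B)) + card (Y ∖ S t B)      ≡⟨ cong (_+ card (Y ∖ S t B)) (*-distribˡ-+ t (r M B) _) ⟩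
        t * r M B + t * card (X′ ∖ B) + card (Y ∖ S t B)    ≡⟨ +-assoc (t * r M B) _ _ ⟩
        t * r M B + (t * card (X′ ∖ B) + card (Y ∖ S t B))  ≤⟨ +-monoʳ-≤ (t * r M B) split ⟩
        t * r M B + card ((Y ∪ SX′) ∖ S t B)                ≤⟨ tight ⟩
        r N (Y ∪ SX′)                                       ∎

lemma3p6 : ∀ {n : ℕ} (t : ℕ) (M : Matroid (FinU n)) (Mt : Matroid (ProdU n t))
           (X : Subset (FinU n)) →
           X ⊆ E M →
           IsExpansion t M Mt →
           IsExpansion t (M ∣ X) (Mt ∣ S t X) × IsExpansion t (M / X) (Mt / S t X)
lemma3p6 t M Mt X _ Mt-is-M^t =
  ExpandedRank⇒IsExpansion t (ExpandedRank-∣ t X ρ) ,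
  ExpandedRank⇒IsExpansion t (ExpandedRank-/ t X ρ)
  where
  ρ : ExpandedRank t M Mt
  ρ = IsExpansion⇒ExpandedRank t Mt-is-M^t
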